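{- Let $u$ be a state of $\mathcal U$, $\nu$ an abstract transition and $f$ a relabelling. If $u\models\mathit{en}(\nu)$, then $u[f]\models\mathit{en}(\nu[f])$.
   Context: ABC: sets $\mathcal A$ (agent identifiers), $\mathcal B$ (broadcast names), $\mathcal C$ (handshake names); $H=\mathcal C\cup\{\bar c\mid c\in\mathcal C\}$, $\bar{\bar c}=c$; $Act=\mathcal B!\cup\mathcal B?\cup H\cup\{\tau\}$ with $\mathcal B!=\{b!\}$, $\mathcal B?=\{b?\}$. A relabelling $f$ maps $\mathcal B\to\mathcal B$, $\mathcal C\to\mathcal C$, extended by $f(\bar c)=\overline{f(c)}$, $f(b\sharp)=f(b)\sharp$, $f(\tau)=\tau$. Expressions: $0$, $\alpha.E$, $E+F$, $E|F$, $E\backslash c$ ($c\in H$), $E[f]$, $A\in\mathcal A$ with guarded defining equations $A\stackrel{def}{=}P$. Transitions are given by the rules (with $\eta\in H\cup\{\tau\}$): (Act) $\alpha.E\xrightarrow{\alpha}E$; (Sum-l/r) a transition of $E$ (resp. $F$) is a transition of $E+F$; (Par-l/r) $E\xrightarrow{\eta}E'$ gives $E|F\xrightarrow{\eta}E'|F$, and symmetrically; (Comm) $E\xrightarrow{c}E'$, $F\xrightarrow{\bar c}F'$ give $E|F\xrightarrow{\tau}E'|F'$; (Bro-l) $E\xrightarrow{b\sharp_1}E'$ ($\sharp_1\in\{!,?\}$) and $F$ has no $b?$-transition give $E|F\xrightarrow{b\sharp_1}E'|F$; (Bro-r) symmetric; (Bro-c) $E\xrightarrow{b\sharp_1}E'$,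 $F\xrightarrow{b\sharp_2}F'$ give $E|F\xrightarrow{b(\sharp_1\circ\sharp_2)}E'|F'$ with $!\circ?=?\circ!=!$, $?\circ?=?$, $!\circ!$ undefined; (Rel) $E\xrightarrow{\ell}E'$ gives $E[f]\xrightarrow{f(\ell)}E'[f]$; (Res) $E\xrightarrow{\ell}E'$, $\ell\notin\{c,\bar c\}$ give $E\backslash c\xrightarrow{\ell}E'\backslash c$; (Rec) $P\xrightarrow{\ell}E'$, $A\stackrel{def}{=}P$ give $A\xrightarrow{\ell}E'$. Derivations of transitions are named: $(\alpha\to P)$ for (Act); $\chi|\zeta$ for (Comm)/(Bro-c); $\chi|Q$ for (Par-l)/(Bro-l); $P|\zeta$ for (Par-r)/(Bro-r); $\chi{+}Q$, $P{+}\chi$, $\chi[f]$, $\chi\backslash c$, $A{:}\chi$ for (Sum-l), (Sum-r), (Rel), (Res), (Rec); $src,target,\ell$ give source, target, label. The states of $\mathcal U$ are the expressions and the derivations; for a state $u$, $u[f]$ is the expression $u[f]$ or the derivation $u[f]$ (by (Rel)). Concurrency $\smile^\bullet$ is the smallest relation on derivations such that (whenever the composed derivations exist): $\chi|Q\smile^\bullet P|\zeta$ and $P|\zeta\smile^\bullet\chi|Q$ if $src(\chi)=P$, $src(\zeta)=Q$; $\chi|\varsigma\smile^\bullet P|\zeta$ and $\varsigma|\chi\smile^\bullet\zeta|P$ if $src(\chi)=P$, $src(\varsigma)=src(\zeta)$, $\ell(\varsigma)\in\mathcal B?$; $\chi\smile^\bullet\zeta$ implies $\chi{+}P\smile^\bullet\zeta{+}P$,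 $P{+}\chi\smile^\bullet P{+}\zeta$, $\chi|P\smile^\bullet\zeta|P$, $P|\chi\smile^\bullet P|\zeta$; $\chi\smile^\bullet\zeta$ implies $\chi|P\smile^\bullet\zeta|\xi$, $\chi|\xi\smile^\bullet\zeta|P$, $P|\chi\smile^\bullet\xi|\zeta$, $\xi|\chi\smile^\bullet P|\zeta$ if $P=src(\xi)$; $\chi\smile^\bullet\zeta$ implies $\chi|\varsigma\smile^\bullet\zeta|\xi$ and $\varsigma|\chi\smile^\bullet\xi|\zeta$ if $src(\varsigma)=src(\xi)$, $\ell(\varsigma)\in\mathcal B?$; $\chi\smile^\bullet\zeta$ and $\varsigma\smile^\bullet\xi$ imply $\chi|\varsigma\smile^\bullet\zeta|\xi$; $\chi\smile^\bullet\zeta$ implies $\chi\backslash c\smile^\bullet\zeta\backslash c$, $\chi[f]\smile^\bullet\zeta[f]$, $A{:}\chi\smile^\bullet A{:}\zeta$. $\equiv$ is the smallest equivalence on derivations $\chi$ with $\ell(\chi)\notin\mathcal B?$ such that (whenever derivations exist): $\chi|P\equiv\chi|Q$, $P|\chi\equiv Q|\chi$; $\chi|\varsigma\equiv\chi|P$, $\varsigma|\chi\equiv P|\chi$ if $\ell(\chi)\in\mathcal B!$; $\chi{+}P\equiv\chi\equiv P{+}\chi$, $A{:}\chi\equiv\chi$; $\chi\equiv\zeta$ implies $\chi\backslash c\equiv\zeta\backslash c$, $\chi[f]\equiv\zeta[f]$, $\chi|P\equiv\zeta|P$, $P|\chi\equiv P|\zeta$; $\chi\equiv\zeta$, $\varsigma\equiv\xi$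 imply $\chi|\varsigma\equiv\zeta|\xi$. Abstract transitions are the $\equiv$-classes (elements: representatives). $\nu[f]$ denotes the abstract transition containing $\chi[f]$ for $\chi\in\nu$. $P\models\mathit{en}(\nu)$ for an expression $P$ iff $P=src(\chi)$ for some representative $\chi$ of $\nu$; $\zeta\models\mathit{en}(\nu)$ for a derivation $\zeta$ iff $\chi\smile^\bullet\zeta$ for some representative $\chi$ of $\nu$. -}

module Defs where

open import Data.Product using (Σ; _×_; _,_; ∃)
open import Data.Sum using (_⊎_; inj₁; inj₂)
open import Relation.Nullary using (¬_)
open import Relation.Binary.PropositionalEquality using (_≡_; _≢_)
open import Data.Empty using (⊥)
open import Data.Unit using (⊤)

-- The calculus ABC, parameterised by the sets of agent identifiers 𝒜,
-- broadcast names ℬ and handshake names 𝒞.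
module ABC (𝒜 ℬ 𝒞 : Set) where

  data H : Set where
    nm : 𝒞 → H
    co : 𝒞 → H

  bar : H → H
  bar (nm c) = co c
  bar (co c) = nm c

  data Mode : Set where
    snd rcv : Mode

  data Act : Set where
    bc : ℬ → Mode → Act
    hs : H → Act
    τ  : Act

  data Compose : Mode → Mode → Mode → Set where
    c-sr : Compose snd rcv snd
    c-rs : Compose rcv snd snd
    c-rr : Compose rcv rcv rcv

  data Sync : Act → Act → Act → Set where
    comm : ∀ {h} → Sync (hs h) (hs (bar h)) τ
    broc : ∀ {b m₁ m₂ m} → Compose m₁ m₂ m → Sync (bc b m₁) (bc b m₂) (bc b m)

  data IsQ : Act → Set where
    isQ : ∀ {b} → IsQ (bc b rcv)

  data IsBang : Act → Set where
    isBang : ∀ {b} → IsBang (bc b snd)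

  record Relabelling : Set where
    field
      fB : ℬ → ℬ
      fC : 𝒞 → 𝒞
  open Relabelling public

  fH : Relabelling → H → H
  fH f (nm c) = nm (fC f c)
  fH f (co c) = co (fC f c)

  fAct : Relabelling → Act → Act
  fAct f (bc b m) = bc (fB f b) m
  fAct f (hs h)   = hs (fH f h)
  fAct f τ        = τ

  infixr 6 _∙_
  infixl 4 _⊕_
  infixl 5 _∥_
  data Expr : Set where
    𝟎    : Expr
    _∙_  : Act → Expr → Expr
    _⊕_  : Expr → Expr → Expr
    _∥_  : Expr → Expr → Expr
    _∖_  : Expr → H → Expr
    _⟦_⟧ : Expr → Relabelling → Expr
    ag   : 𝒜 → Expr

  Guarded : Expr → Set
  Guarded 𝟎 = ⊤
  Guarded (α ∙ E) = ⊤
  Guarded (E ⊕ F) = Guarded E × Guarded F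
  Guarded (E ∥ F) = Guarded E × Guarded F
  Guarded (E ∖ c) = Guarded E
  Guarded (E ⟦ f ⟧) = Guarded E
  Guarded (ag A) = ⊥

  -- Semantics relative to the defining equations A ≝ def A
  module Sem (def : 𝒜 → Expr) where

    -- "E has a b?-transition" (positive characterisation)
    data CanRecv (b : ℬ) : Expr → Set where
      cr-act  : ∀ {E} → CanRecv b (bc b rcv ∙ E)
      cr-sumL : ∀ {E F} → CanRecv b E → CanRecv b (E ⊕ F)
      cr-sumR : ∀ {E F} → CanRecv b F → CanRecv b (E ⊕ F)
      cr-parL : ∀ {E F} → CanRecv b E → CanRecv b (E ∥ F)
      cr-parR : ∀ {E F} → CanRecv b F → CanRecv b (E ∥ F)
      cr-rel  : ∀ {E f b'} → CanRecv b' E → fB f b' ≡ b → CanRecv b (E ⟦ f ⟧)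
      cr-res  : ∀ {E c} → CanRecv b E → CanRecv b (E ∖ c)
      cr-rec  : ∀ {A} → CanRecv b (def A) → CanRecv b (ag A)

    -- side condition of (Par-l/r) resp. (Bro-l/r) for a component with label ℓ
    -- when the other component is F
    data SideOK : Act → Expr → Set where
      ok-hs : ∀ {h F} → SideOK (hs h) F
      ok-τ  : ∀ {F} → SideOK τ F
      ok-br : ∀ {b m F} → ¬ CanRecv b F → SideOK (bc b m) F

    -- derivations of transitions (proof-relevant)
    data _─[_]→_ : Expr → Act → Expr → Set where
      act  : ∀ {α E} → (α ∙ E) ─[ α ]→ E
      sumL : ∀ {E F ℓ E'} → E ─[ ℓ ]→ E' → (E ⊕ F) ─[ ℓ ]→ E'
      sumR : ∀ {E F ℓ F'} → F ─[ ℓ ]→ F' → (E ⊕ F) ─[ ℓ ]→ F'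
      parL : ∀ {E F ℓ E'} → E ─[ ℓ ]→ E' → SideOK ℓ F → (E ∥ F) ─[ ℓ ]→ (E' ∥ F)
      parR : ∀ {E F ℓ F'} → F ─[ ℓ ]→ F' → SideOK ℓ E → (E ∥ F) ─[ ℓ ]→ (E ∥ F')
      sync : ∀ {E F ℓ₁ ℓ₂ ℓ E' F'} → E ─[ ℓ₁ ]→ E' → F ─[ ℓ₂ ]→ F' → Sync ℓ₁ ℓ₂ ℓ
             → (E ∥ F) ─[ ℓ ]→ (E' ∥ F')
      rel  : ∀ {E ℓ E'} (f : Relabelling) → E ─[ ℓ ]→ E' → (E ⟦ f ⟧) ─[ fAct f ℓ ]→ (E' ⟦ f ⟧)
      res  : ∀ {E ℓ E' c} → E ─[ ℓ ]→ E' → ℓ ≢ hs c → ℓ ≢ hs (bar c) → (E ∖ c) ─[ ℓ ]→ (E' ∖ c)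
      rec  : ∀ {A ℓ E'} → def A ─[ ℓ ]→ E' → ag A ─[ ℓ ]→ E'

    record Der : Set where
      constructor ⟨_⟩
      field
        {src} : Expr
        {lab} : Act
        {tgt} : Expr
        pf    : src ─[ lab ]→ tgt
    open Der public

    data _⌣_ : Der → Der → Set where
      c-LR  : ∀ {P Q ℓ k P' Q'} (χ : P ─[ ℓ ]→ P') (ζ : Q ─[ k ]→ Q') o₁ o₂
              → ⟨ parL {F = Q} χ o₁ ⟩ ⌣ ⟨ parR {E = P} ζ o₂ ⟩
      c-RL  : ∀ {P Q ℓ k P' Q'} (χ : P ─[ ℓ ]→ P') (ζ : Q ─[ k ]→ Q') o₁ o₂
              → ⟨ parR {E = P} ζ o₂ ⟩ ⌣ ⟨ parL {F = Q} χ o₁ ⟩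
      c-SR  : ∀ {P Q ℓ b k P' Q' Q'' ℓ'} (χ : P ─[ ℓ ]→ P') (ς : Q ─[ bc b rcv ]→ Q')
              (ζ : Q ─[ k ]→ Q'') (s : Sync ℓ (bc b rcv) ℓ') o
              → ⟨ sync χ ς s ⟩ ⌣ ⟨ parR {E = P} ζ o ⟩
      c-SL  : ∀ {P Q ℓ b k P' Q' Q'' ℓ'} (χ : P ─[ ℓ ]→ P') (ς : Q ─[ bc b rcv ]→ Q')
              (ζ : Q ─[ k ]→ Q'') (s : Sync (bc b rcv) ℓ ℓ') o
              → ⟨ sync ς χ s ⟩ ⌣ ⟨ parL {F = P} ζ o ⟩
      c-sumL : ∀ {E₁ E₂ ℓ₁ ℓ₂ E₁' E₂'} {P} {χ : E₁ ─[ ℓ₁ ]→ E₁'} {ζ : E₂ ─[ ℓ₂ ]→ E₂'}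
               → ⟨ χ ⟩ ⌣ ⟨ ζ ⟩ → ⟨ sumL {F = P} χ ⟩ ⌣ ⟨ sumL {F = P} ζ ⟩
      c-sumR : ∀ {E₁ E₂ ℓ₁ ℓ₂ E₁' E₂'} {P} {χ : E₁ ─[ ℓ₁ ]→ E₁'} {ζ : E₂ ─[ ℓ₂ ]→ E₂'}
               → ⟨ χ ⟩ ⌣ ⟨ ζ ⟩ → ⟨ sumR {E = P} χ ⟩ ⌣ ⟨ sumR {E = P} ζ ⟩
      c-parL : ∀ {E₁ E₂ ℓ₁ ℓ₂ E₁' E₂'} {P} {χ : E₁ ─[ ℓ₁ ]→ E₁'} {ζ : E₂ ─[ ℓ₂ ]→ E₂'} o₁ o₂
               → ⟨ χ ⟩ ⌣ ⟨ ζ ⟩ → ⟨ parL {F = P} χ o₁ ⟩ ⌣ ⟨ parL {F = P} ζ o₂ ⟩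
      c-parR : ∀ {E₁ E₂ ℓ₁ ℓ₂ E₁' E₂'} {P} {χ : E₁ ─[ ℓ₁ ]→ E₁'} {ζ : E₂ ─[ ℓ₂ ]→ E₂'} o₁ o₂
               → ⟨ χ ⟩ ⌣ ⟨ ζ ⟩ → ⟨ parR {E = P} χ o₁ ⟩ ⌣ ⟨ parR {E = P} ζ o₂ ⟩
      c-L-S  : ∀ {E₁ E₂ ℓ₁ ℓ₂ E₁' E₂' P k P' ℓ} {χ : E₁ ─[ ℓ₁ ]→ E₁'} {ζ : E₂ ─[ ℓ₂ ]→ E₂'}
               (ξ : P ─[ k ]→ P') (o : SideOK ℓ₁ P) (s : Sync ℓ₂ k ℓ)
               → ⟨ χ ⟩ ⌣ ⟨ ζ ⟩ → ⟨ parL χ o ⟩ ⌣ ⟨ sync ζ ξ s ⟩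
      c-S-L  : ∀ {E₁ E₂ ℓ₁ ℓ₂ E₁' E₂' P k P' ℓ} {χ : E₁ ─[ ℓ₁ ]→ E₁'} {ζ : E₂ ─[ ℓ₂ ]→ E₂'}
               (ξ : P ─[ k ]→ P') (o : SideOK ℓ₂ P) (s : Sync ℓ₁ k ℓ)
               → ⟨ χ ⟩ ⌣ ⟨ ζ ⟩ → ⟨ sync χ ξ s ⟩ ⌣ ⟨ parL ζ o ⟩
      c-R-S  : ∀ {E₁ E₂ ℓ₁ ℓ₂ E₁' E₂' P k P' ℓ} {χ : E₁ ─[ ℓ₁ ]→ E₁'} {ζ : E₂ ─[ ℓ₂ ]→ E₂'}
               (ξ : P ─[ k ]→ P') (o : SideOK ℓ₁ P) (s : Sync k ℓ₂ ℓ)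
               → ⟨ χ ⟩ ⌣ ⟨ ζ ⟩ → ⟨ parR χ o ⟩ ⌣ ⟨ sync ξ ζ s ⟩
      c-S-R  : ∀ {E₁ E₂ ℓ₁ ℓ₂ E₁' E₂' P k P' ℓ} {χ : E₁ ─[ ℓ₁ ]→ E₁'} {ζ : E₂ ─[ ℓ₂ ]→ E₂'}
               (ξ : P ─[ k ]→ P') (o : SideOK ℓ₂ P) (s : Sync k ℓ₁ ℓ)
               → ⟨ χ ⟩ ⌣ ⟨ ζ ⟩ → ⟨ sync ξ χ s ⟩ ⌣ ⟨ parR ζ o ⟩
      c-SS-l : ∀ {E₁ E₂ ℓ₁ ℓ₂ E₁' E₂' P b k P' P'' ℓ ℓ'} {χ : E₁ ─[ ℓ₁ ]→ E₁'} {ζ : E₂ ─[ ℓ₂ ]→ E₂'}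
               (ς : P ─[ bc b rcv ]→ P') (ξ : P ─[ k ]→ P'') (s₁ : Sync ℓ₁ (bc b rcv) ℓ) (s₂ : Sync ℓ₂ k ℓ')
               → ⟨ χ ⟩ ⌣ ⟨ ζ ⟩ → ⟨ sync χ ς s₁ ⟩ ⌣ ⟨ sync ζ ξ s₂ ⟩
      c-SS-r : ∀ {E₁ E₂ ℓ₁ ℓ₂ E₁' E₂' P b k P' P'' ℓ ℓ'} {χ : E₁ ─[ ℓ₁ ]→ E₁'} {ζ : E₂ ─[ ℓ₂ ]→ E₂'}
               (ς : P ─[ bc b rcv ]→ P') (ξ : P ─[ k ]→ P'') (s₁ : Sync (bc b rcv) ℓ₁ ℓ) (s₂ : Sync k ℓ₂ ℓ')
               → ⟨ χ ⟩ ⌣ ⟨ ζ ⟩ → ⟨ sync ς χ s₁ ⟩ ⌣ ⟨ sync ξ ζ s₂ ⟩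
      c-SS   : ∀ {E₁ E₂ ℓ₁ ℓ₂ E₁' E₂' F₁ F₂ k₁ k₂ F₁' F₂' ℓ ℓ'}
               {χ : E₁ ─[ ℓ₁ ]→ E₁'} {ζ : E₂ ─[ ℓ₂ ]→ E₂'}
               {ς : F₁ ─[ k₁ ]→ F₁'} {ξ : F₂ ─[ k₂ ]→ F₂'} (s₁ : Sync ℓ₁ k₁ ℓ) (s₂ : Sync ℓ₂ k₂ ℓ')
               → ⟨ χ ⟩ ⌣ ⟨ ζ ⟩ → ⟨ ς ⟩ ⌣ ⟨ ξ ⟩ → ⟨ sync χ ς s₁ ⟩ ⌣ ⟨ sync ζ ξ s₂ ⟩
      c-res  : ∀ {E₁ E₂ ℓ₁ ℓ₂ E₁' E₂' c} {χ : E₁ ─[ ℓ₁ ]→ E₁'} {ζ : E₂ ─[ ℓ₂ ]→ E₂'} p₁ p₂ q₁ q₂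
               → ⟨ χ ⟩ ⌣ ⟨ ζ ⟩ → ⟨ res {c = c} χ p₁ q₁ ⟩ ⌣ ⟨ res {c = c} ζ p₂ q₂ ⟩
      c-rel  : ∀ {E₁ E₂ ℓ₁ ℓ₂ E₁' E₂'} {χ : E₁ ─[ ℓ₁ ]→ E₁'} {ζ : E₂ ─[ ℓ₂ ]→ E₂'} (f : Relabelling)
               → ⟨ χ ⟩ ⌣ ⟨ ζ ⟩ → ⟨ rel f χ ⟩ ⌣ ⟨ rel f ζ ⟩
      c-rec  : ∀ {A ℓ₁ ℓ₂ E₁' E₂'} {χ : def A ─[ ℓ₁ ]→ E₁'} {ζ : def A ─[ ℓ₂ ]→ E₂'}
               → ⟨ χ ⟩ ⌣ ⟨ ζ ⟩ → ⟨ rec χ ⟩ ⌣ ⟨ rec ζ ⟩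

    -- the equivalence ≡ on derivations with label ∉ ℬ?
    -- (smallest equivalence relation on that set closed under the rules)
    data _≅_ : Der → Der → Set where
      e-refl  : ∀ {χ} → ¬ IsQ (lab χ) → χ ≅ χ
      e-sym   : ∀ {χ ζ} → χ ≅ ζ → ζ ≅ χ
      e-trans : ∀ {χ ζ ξ} → χ ≅ ζ → ζ ≅ ξ → χ ≅ ξ
      e-parL  : ∀ {E ℓ E' P Q} {χ : E ─[ ℓ ]→ E'} o₁ o₂ → ¬ IsQ ℓ
                → ⟨ parL {F = P} χ o₁ ⟩ ≅ ⟨ parL {F = Q} χ o₂ ⟩
      e-parR  : ∀ {E ℓ E' P Q} {χ : E ─[ ℓ ]→ E'} o₁ o₂ → ¬ IsQ ℓ
                → ⟨ parR {E = P} χ o₁ ⟩ ≅ ⟨ parR {E = Q} χ o₂ ⟩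
      e-syncL : ∀ {E ℓ E' F k F' P ℓ'} {χ : E ─[ ℓ ]→ E'} (ς : F ─[ k ]→ F') (s : Sync ℓ k ℓ') o
                → IsBang ℓ → ⟨ sync χ ς s ⟩ ≅ ⟨ parL {F = P} χ o ⟩
      e-syncR : ∀ {E ℓ E' F k F' P ℓ'} {χ : E ─[ ℓ ]→ E'} (ς : F ─[ k ]→ F') (s : Sync k ℓ ℓ') o
                → IsBang ℓ → ⟨ sync ς χ s ⟩ ≅ ⟨ parR {E = P} χ o ⟩
      e-sumL  : ∀ {E ℓ E' P} {χ : E ─[ ℓ ]→ E'} → ¬ IsQ ℓ → ⟨ sumL {F = P} χ ⟩ ≅ ⟨ χ ⟩
      e-sumR  : ∀ {E ℓ E' P} {χ : E ─[ ℓ ]→ E'} → ¬ IsQ ℓ → ⟨ χ ⟩ ≅ ⟨ sumR {E = P} χ ⟩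
      e-rec   : ∀ {A ℓ E'} {χ : def A ─[ ℓ ]→ E'} → ¬ IsQ ℓ → ⟨ rec χ ⟩ ≅ ⟨ χ ⟩
      e-res   : ∀ {E₁ E₂ ℓ₁ ℓ₂ E₁' E₂' c} {χ : E₁ ─[ ℓ₁ ]→ E₁'} {ζ : E₂ ─[ ℓ₂ ]→ E₂'} p₁ p₂ q₁ q₂
                → ⟨ χ ⟩ ≅ ⟨ ζ ⟩ → ⟨ res {c = c} χ p₁ q₁ ⟩ ≅ ⟨ res {c = c} ζ p₂ q₂ ⟩
      e-rel   : ∀ {E₁ E₂ ℓ₁ ℓ₂ E₁' E₂'} {χ : E₁ ─[ ℓ₁ ]→ E₁'} {ζ : E₂ ─[ ℓ₂ ]→ E₂'} (f : Relabelling)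
                → ⟨ χ ⟩ ≅ ⟨ ζ ⟩ → ⟨ rel f χ ⟩ ≅ ⟨ rel f ζ ⟩
      e-cparL : ∀ {E₁ E₂ ℓ₁ ℓ₂ E₁' E₂' P} {χ : E₁ ─[ ℓ₁ ]→ E₁'} {ζ : E₂ ─[ ℓ₂ ]→ E₂'} o₁ o₂
                → ⟨ χ ⟩ ≅ ⟨ ζ ⟩ → ⟨ parL {F = P} χ o₁ ⟩ ≅ ⟨ parL {F = P} ζ o₂ ⟩
      e-cparR : ∀ {E₁ E₂ ℓ₁ ℓ₂ E₁' E₂' P} {χ : E₁ ─[ ℓ₁ ]→ E₁'} {ζ : E₂ ─[ ℓ₂ ]→ E₂'} o₁ o₂
                → ⟨ χ ⟩ ≅ ⟨ ζ ⟩ → ⟨ parR {E = P} χ o₁ ⟩ ≅ ⟨ parR {E = P} ζ o₂ ⟩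
      e-sync  : ∀ {E₁ E₂ ℓ₁ ℓ₂ E₁' E₂' F₁ F₂ k₁ k₂ F₁' F₂' ℓ ℓ'}
                {χ : E₁ ─[ ℓ₁ ]→ E₁'} {ζ : E₂ ─[ ℓ₂ ]→ E₂'}
                {ς : F₁ ─[ k₁ ]→ F₁'} {ξ : F₂ ─[ k₂ ]→ F₂'} (s₁ : Sync ℓ₁ k₁ ℓ) (s₂ : Sync ℓ₂ k₂ ℓ')
                → ⟨ χ ⟩ ≅ ⟨ ζ ⟩ → ⟨ ς ⟩ ≅ ⟨ ξ ⟩ → ⟨ sync χ ς s₁ ⟩ ≅ ⟨ sync ζ ξ s₂ ⟩

    -- abstract transitions: ≡-classes, given by a representative (label ∉ ℬ?)
    record AbsTr : Set where
      constructor [_,_]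
      field
        rep   : Der
        repNQ : ¬ IsQ (lab rep)
    open AbsTr public

    _∈ν_ : Der → AbsTr → Set
    χ ∈ν ν = χ ≅ rep ν

    fAct-NQ : (f : Relabelling) {ℓ : Act} → ¬ IsQ ℓ → ¬ IsQ (fAct f ℓ)
    fAct-NQ f {bc b rcv} nq _ = nq isQ
    fAct-NQ f {bc b snd} nq ()
    fAct-NQ f {hs h} nq ()
    fAct-NQ f {τ} nq ()

    _[_]ₐ : AbsTr → Relabelling → AbsTr
    ν [ f ]ₐ = [ ⟨ rel f (pf (rep ν)) ⟩ , fAct-NQ f (repNQ ν) ]

    -- states of 𝒰: expressions and derivations
    State : Set
    State = Expr ⊎ Der

    _[_]ₛ : State → Relabelling → State
    inj₁ P [ f ]ₛ = inj₁ (P ⟦ f ⟧)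
    inj₂ χ [ f ]ₛ = inj₂ ⟨ rel f (pf χ) ⟩

    _⊨en_ : State → AbsTr → Set
    inj₁ P ⊨en ν = Σ Der λ χ → χ ∈ν ν × src χ ≡ P
    inj₂ ζ ⊨en ν = Σ Der λ χ → χ ∈ν ν × χ ⌣ ζ

module Submission where

open import Defs
open import Data.Product using (_,_)
open import Data.Sum using (inj₁; inj₂)
open import Relation.Binary.PropositionalEquality using (refl)

-- Relabelling is a congruence for both ≡ and ⌣•, so the witness of
-- u ⊨ en(ν) relabelled by f witnesses u[f] ⊨ en(ν[f]).

module Relabel (𝒜 ℬ 𝒞 : Set) (def : 𝒜 → ABC.Expr 𝒜 ℬ 𝒞) where
  open ABC 𝒜 ℬ 𝒞
  open Sem def

  _[_]ᵈ : Der → Relabelling → Der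
  χ [ f ]ᵈ = ⟨ rel f (pf χ) ⟩

  ∈ν-relabel : ∀ {χ} ν f → χ ∈ν ν → (χ [ f ]ᵈ) ∈ν (ν [ f ]ₐ)
  ∈ν-relabel ν f = e-rel f

  ⌣-relabel : ∀ {χ ζ} f → χ ⌣ ζ → (χ [ f ]ᵈ) ⌣ (ζ [ f ]ᵈ)
  ⌣-relabel f = c-rel f

  ⊨en-relabel : ∀ u ν f → u ⊨en ν → (u [ f ]ₛ) ⊨en (ν [ f ]ₐ)
  ⊨en-relabel (inj₁ P) ν f (χ , χ∈ν , refl) = χ [ f ]ᵈ , ∈ν-relabel ν f χ∈ν , refl
  ⊨en-relabel (inj₂ ζ) ν f (χ , χ∈ν , χ⌣ζ) = χ [ f ]ᵈ , ∈ν-relabel ν f χ∈ν , ⌣-relabel f χ⌣ζ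

lemma5 : (𝒜 ℬ 𝒞 : Set) → let open ABC 𝒜 ℬ 𝒞 in
    (def : 𝒜 → Expr) → (∀ A → Guarded (def A)) → let open Sem def in
    (u : State) (ν : AbsTr) (f : Relabelling) →
    u ⊨en ν → (u [ f ]ₛ) ⊨en (ν [ f ]ₐ)
lemma5 𝒜 ℬ 𝒞 def _ = Relabel.⊨en-relabel 𝒜 ℬ 𝒞 def
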